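{- For any discrete type $\Gamma\vdash T$ over a bridge/path cubical set $\Gamma$, the type $P\Gamma\vdash PT$ is also discrete.
   Context: $\mathrm{BPCube}$: pairs $W=(W_B,W_P)$ of disjoint finite sets of names; face maps assign to bridge variables values in $\{0,1\}\cup V_B$ and to path variables values in $\{0,1\}\cup V_B\cup V_P$; composition by substitution. Let $\sharp:\mathrm{BPCube}\to\mathrm{BPCube}$ be $\sharp(W_B,W_P)=(\emptyset,W_B\cup W_P)$ with $i\langle\sharp\varphi\rangle=i\langle\varphi\rangle$ (all variables made path variables). For a presheaf $\Gamma$, $P\Gamma:=\Gamma\circ\sharp$; for a type $\Gamma\vdash T$ (sets $T[\gamma]$, restrictions $t\langle\varphi\rangle$), $PT$ over $P\Gamma$ is given by $(PT)[\gamma]:=T[\gamma]$ for $\gamma\in\Gamma(\sharp W)$ with restriction along $\varphi$ being $t\mapsto t\langle\sharp\varphi\rangle$. With $(W,i{:}\mathbb P)$ the extension by a fresh path variable and $(\setminus i)$ the weakening face map, elements are degenerate in $i$ if they are restrictions along $(\setminus i)$; a type is discrete if every $t\in T[\gamma]$ is degenerate in every path variable in which $\gamma$ is degenerate. -}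

module Defs where

open import Level using (Level; suc; _⊔_)
open import Data.Nat using (ℕ; zero; _+_)
open import Data.Fin using (Fin; _↑ˡ_; _↑ʳ_; splitAt; punchIn)
open import Data.Fin.Properties using (splitAt-↑ˡ; splitAt-↑ʳ; splitAt⁻¹-↑ˡ; splitAt⁻¹-↑ʳ)
open import Data.Sum using (_⊎_; inj₁; inj₂; [_,_]′)
open import Data.Product using (Σ; Σ-syntax; _,_)
open import Relation.Binary.PropositionalEquality
  using (_≡_; refl; sym; trans; cong; subst; subst-subst; inspect)

-- An object W = (W_B , W_P) of disjoint finite sets of names is given up to
-- renaming by its numbers of bridge and path variables: bridge variables
-- are Fin nb, path variables are Fin np (disjoint by construction).

record Ctx : Set where
  constructor _∣_
  field
    nb : ℕ
    np : ℕ
open Ctx public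

data BVal (b : ℕ) : Set where
  b0 b1 : BVal b
  bv    : Fin b → BVal b

data PVal (b p : ℕ) : Set where
  p0 p1 : PVal b p
  pb    : Fin b → PVal b p
  pp    : Fin p → PVal b p

-- a face map φ : V → W assigns to every variable of W a value over V
record Hom (V W : Ctx) : Set where
  constructor hom
  field
    bmap : Fin (nb W) → BVal (nb V)
    pmap : Fin (np W) → PVal (nb V) (np V)
open Hom public

record _≈H_ {V W : Ctx} (φ ψ : Hom V W) : Set where
  constructor mk≈
  field
    b≈ : ∀ i → bmap φ i ≡ bmap ψ i
    p≈ : ∀ i → pmap φ i ≡ pmap ψ i

B→P : ∀ {b p} → BVal b → PVal b p
B→P b0     = p0
B→P b1     = p1
B→P (bv i) = pb i

idH : ∀ {W} → Hom W W
idH = hom bv pp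

substB : ∀ {U V} → Hom U V → BVal (nb V) → BVal (nb U)
substB ψ b0     = b0
substB ψ b1     = b1
substB ψ (bv i) = bmap ψ i

substP : ∀ {U V} → Hom U V → PVal (nb V) (np V) → PVal (nb U) (np U)
substP ψ p0     = p0
substP ψ p1     = p1
substP ψ (pb i) = B→P (bmap ψ i)
substP ψ (pp i) = pmap ψ i

_∘H_ : ∀ {U V W} → Hom V W → Hom U V → Hom U W
φ ∘H ψ = hom (λ i → substB ψ (bmap φ i)) (λ i → substP ψ (pmap φ i))

record PSh : Set₁ where
  field
    Ob     : Ctx → Set
    restr  : ∀ {V W} → Hom V W → Ob W → Ob V
    restr-≈  : ∀ {V W} {φ ψ : Hom V W} → φ ≈H ψ → ∀ γ → restr φ γ ≡ restr ψ γ
    restr-id : ∀ {W} (γ : Ob W) → restr idH γ ≡ γ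
    restr-∘  : ∀ {U V W} (φ : Hom V W) (ψ : Hom U V) (γ : Ob W) →
               restr (φ ∘H ψ) γ ≡ restr ψ (restr φ γ)

record Ty (Γ : PSh) : Set₁ where
  open PSh Γ
  field
    Fam    : ∀ {W} → Ob W → Set
    restrT : ∀ {V W} (φ : Hom V W) {γ : Ob W} → Fam γ → Fam (restr φ γ)
    restrT-≈  : ∀ {V W} {φ ψ : Hom V W} (e : φ ≈H ψ) {γ : Ob W} (t : Fam γ) →
                subst Fam (restr-≈ e γ) (restrT φ t) ≡ restrT ψ t
    restrT-id : ∀ {W} {γ : Ob W} (t : Fam γ) →
                subst Fam (restr-id γ) (restrT idH t) ≡ t
    restrT-∘  : ∀ {U V W} (φ : Hom V W) (ψ : Hom U V) {γ : Ob W} (t : Fam γ) →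
                subst Fam (restr-∘ φ ψ γ) (restrT (φ ∘H ψ) t) ≡ restrT ψ (restrT φ t)

-- The path variables of ♯W are Fin (nb W + np W): the first nb W of them are
-- the (former) bridge variables, the remaining np W the path variables.

♯ : Ctx → Ctx
♯ W = 0 ∣ (nb W + np W)

-- a value over V, read as a value over ♯V (same variable, now a path variable)
♯val : ∀ {b p} → PVal b p → PVal 0 (b + p)
♯val {b} {p} p0     = p0
♯val {b} {p} p1     = p1
♯val {b} {p} (pb i) = pp (i ↑ˡ p)
♯val {b} {p} (pp i) = pp (b ↑ʳ i)

♯case : ∀ {V W} → Hom V W → Fin (nb W) ⊎ Fin (np W) → PVal 0 (nb V + np V)
♯case φ (inj₁ i) = ♯val (B→P (bmap φ i))
♯case φ (inj₂ i) = ♯val (pmap φ i)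

♯H : ∀ {V W} → Hom V W → Hom (♯ V) (♯ W)
♯H {V} {W} φ = hom (λ ()) (λ k → ♯case φ (splitAt (nb W) k))

private
  ♯H-≈ : ∀ {V W} {φ ψ : Hom V W} → φ ≈H ψ → ♯H φ ≈H ♯H ψ
  ♯H-≈ {V} {W} {φ} {ψ} (mk≈ b≈ p≈) = mk≈ (λ ()) λ k → go (splitAt (nb W) k)
    where
    go : ∀ s → ♯case φ s ≡ ♯case ψ s
    go (inj₁ i) = cong (λ v → ♯val (B→P v)) (b≈ i)
    go (inj₂ i) = cong ♯val (p≈ i)

  ♯H-id : ∀ {W} → ♯H (idH {W}) ≈H idH
  ♯H-id {W} = mk≈ (λ ()) λ k → go k (splitAt (nb W) k) refl
    where
    go : ∀ k s → splitAt (nb W) k ≡ s → ♯case (idH {W}) s ≡ pp k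
    go k (inj₁ i) e = cong pp (splitAt⁻¹-↑ˡ e)
    go k (inj₂ i) e = cong pp (splitAt⁻¹-↑ʳ e)

  ♯substB : ∀ {U V} (ψ : Hom U V) (v : BVal (nb V)) →
            ♯val {nb U} {np U} (B→P (substB ψ v)) ≡ substP (♯H ψ) (♯val {nb V} {np V} (B→P v))
  ♯substB ψ b0 = refl
  ♯substB ψ b1 = refl
  ♯substB {U} {V} ψ (bv i) rewrite splitAt-↑ˡ (nb V) i (np V) = refl

  ♯substP : ∀ {U V} (ψ : Hom U V) (v : PVal (nb V) (np V)) →
            ♯val (substP ψ v) ≡ substP (♯H ψ) (♯val v)
  ♯substP ψ p0 = refl
  ♯substP ψ p1 = refl
  ♯substP {U} {V} ψ (pb i) rewrite splitAt-↑ˡ (nb V) i (np V) = refl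
  ♯substP {U} {V} ψ (pp i) rewrite splitAt-↑ʳ (nb V) (np V) i = refl

  ♯H-∘ : ∀ {U V W} (φ : Hom V W) (ψ : Hom U V) → ♯H (φ ∘H ψ) ≈H (♯H φ ∘H ♯H ψ)
  ♯H-∘ {U} {V} {W} φ ψ = mk≈ (λ ()) λ k → go (splitAt (nb W) k)
    where
    go : ∀ s → ♯case (φ ∘H ψ) s ≡ substP (♯H ψ) (♯case φ s)
    go (inj₁ i) = ♯substB ψ (bmap φ i)
    go (inj₂ i) = ♯substP ψ (pmap φ i)

P : PSh → PSh
P Γ = record
  { Ob       = λ W → Ob (♯ W)
  ; restr    = λ φ → restr (♯H φ)
  ; restr-≈  = λ e → restr-≈ (♯H-≈ e)
  ; restr-id = λ {W} γ → trans (restr-≈ (♯H-id {W}) γ) (restr-id γ)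
  ; restr-∘  = λ φ ψ γ → trans (restr-≈ (♯H-∘ φ ψ) γ) (restr-∘ (♯H φ) (♯H ψ) γ)
  }
  where open PSh Γ

PTy : {Γ : PSh} → Ty Γ → Ty (P Γ)
PTy {Γ} T = record
  { Fam       = Fam
  ; restrT    = λ φ → restrT (♯H φ)
  ; restrT-≈  = λ e t → restrT-≈ (♯H-≈ e) t
  ; restrT-id = λ {W} {γ} t →
      trans (sym (subst-subst (restr-≈ (♯H-id {W}) γ)))
            (trans (cong (subst Fam (restr-id γ)) (restrT-≈ (♯H-id {W}) t)) (restrT-id t))
  ; restrT-∘  = λ φ ψ {γ} t →
      trans (sym (subst-subst (restr-≈ (♯H-∘ φ ψ) γ)))
            (trans (cong (subst Fam (restr-∘ (♯H φ) (♯H ψ) γ)) (restrT-≈ (♯H-∘ φ ψ) t))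
                   (restrT-∘ (♯H φ) (♯H ψ) t))
  }
  where open PSh Γ; open Ty T

-- A path variable i of W is an index i : Fin (suc n) of W = (m ∣ suc n);
-- W ∖ i = (m ∣ n), and (W ∖ i , i : ℙ) ≅ W.  The weakening face map
-- (∖ i) : W → W ∖ i sends every variable of W ∖ i to itself.

weaken : ∀ {m n} (i : Fin (ℕ.suc n)) → Hom (m ∣ ℕ.suc n) (m ∣ n)
weaken i = hom bv (λ j → pp (punchIn i j))

module _ (Γ : PSh) where
  open PSh Γ

  DegenerateIn : ∀ {m n} (i : Fin (ℕ.suc n)) → Ob (m ∣ ℕ.suc n) → Set
  DegenerateIn i γ = Σ[ γ' ∈ Ob _ ] restr (weaken i) γ' ≡ γ

module _ {Γ : PSh} (T : Ty Γ) where
  open PSh Γ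
  open Ty T

  DegenerateInT : ∀ {m n} (i : Fin (ℕ.suc n)) {γ : Ob (m ∣ ℕ.suc n)} → Fam γ → Set
  DegenerateInT i {γ} t =
    Σ[ γ' ∈ Ob _ ] Σ[ e ∈ restr (weaken i) γ' ≡ γ ] Σ[ t' ∈ Fam γ' ]
      subst Fam e (restrT (weaken i) t') ≡ t

  Discrete : Set
  Discrete = ∀ {m n} (i : Fin (ℕ.suc n)) (γ : Ob (m ∣ ℕ.suc n)) (t : Fam γ) →
             DegenerateIn Γ i γ → DegenerateInT i t

module Submission where

-- Fix W = (m ∣ suc n) and a path variable i of W.  Degeneracy of an
-- element of P Γ (W) in i is degeneracy of an element of Γ (♯ W) along the
-- face map ♯(∖ i).  Up to a renaming of variables, ♯(∖ i) is an ordinary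
-- weakening: the isomorphism  front : ♯W ≅ (0 ∣ suc N)  that moves the path
-- variable i to position 0 (and keeps the order of the others) satisfies
--   (∖ 0) ∘ front ≈ ♯(∖ i)   and   ♯(∖ i) ∘ front⁻¹ ≈ (∖ 0).
-- So discreteness of T at the variable 0 of (0 ∣ suc N) transfers to the
-- variable i of ♯W.

open import Defs
open import Data.Nat using (ℕ; _+_)
open import Data.Fin using (Fin; zero; suc; _↑ˡ_; _↑ʳ_; splitAt; punchIn; punchOut; _≟_)
open import Data.Fin.Properties
  using (splitAt-↑ˡ; splitAt-↑ʳ; splitAt⁻¹-↑ˡ; splitAt⁻¹-↑ʳ; punchInᵢ≢i; punchIn-punchOut; punchIn-injective)
open import Data.Sum using (_⊎_; inj₁; inj₂)
open import Data.Product using (Σ-syntax; _,_)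
open import Relation.Nullary using (yes; no; contradiction)
open import Relation.Binary.PropositionalEquality using (_≡_; refl; sym; trans; cong; subst)
open import Relation.Binary.HeterogeneousEquality as H using (_≅_)

module _ {Γ : PSh} (T : Ty Γ) where
  open PSh Γ
  open Ty T

  -- The type laws of Defs, with the transports along the equations of Γ
  -- absorbed into heterogeneous equality, so that they compose freely.

  subst-≅ : ∀ {W} {γ₁ γ₂ : Ob W} (e : γ₁ ≡ γ₂) {x : Fam γ₁} {y : Fam γ₂} →
            x ≅ y → subst Fam e x ≡ y
  subst-≅ refl H.refl = refl

  ≅-subst : ∀ {W} {γ₁ γ₂ : Ob W} (e : γ₁ ≡ γ₂) {x : Fam γ₁} {y : Fam γ₂} →
            subst Fam e x ≡ y → x ≅ y
  ≅-subst refl refl = H.refl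

  restrT-≈ᴴ : ∀ {V W} {φ ψ : Hom V W} (e : φ ≈H ψ) {γ : Ob W} (t : Fam γ) →
              restrT φ t ≅ restrT ψ t
  restrT-≈ᴴ e {γ} t = ≅-subst (restr-≈ e γ) (restrT-≈ e t)

  restrT-idᴴ : ∀ {W} {γ : Ob W} (t : Fam γ) → restrT idH t ≅ t
  restrT-idᴴ {γ = γ} t = ≅-subst (restr-id γ) (restrT-id t)

  restrT-∘ᴴ : ∀ {U V W} (φ : Hom V W) (ψ : Hom U V) {γ : Ob W} (t : Fam γ) →
              restrT (φ ∘H ψ) t ≅ restrT ψ (restrT φ t)
  restrT-∘ᴴ φ ψ {γ} t = ≅-subst (restr-∘ φ ψ γ) (restrT-∘ φ ψ t)

  restrT-congᴴ : ∀ {V W} (φ : Hom V W) {γ₁ γ₂ : Ob W} → γ₁ ≡ γ₂ →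
                 {t₁ : Fam γ₁} {t₂ : Fam γ₂} → t₁ ≅ t₂ → restrT φ t₁ ≅ restrT φ t₂
  restrT-congᴴ φ refl H.refl = H.refl

  -- Degeneracy along an arbitrary face map w : U → V; the notions
  -- DegenerateIn / DegenerateInT of Defs are the case w = (∖ i).

  DegenerateAlong : ∀ {U V} → Hom U V → Ob U → Set
  DegenerateAlong {V = V} w γ = Σ[ γ' ∈ Ob V ] restr w γ' ≡ γ

  DegenerateAlongT : ∀ {U V} → Hom U V → {γ : Ob U} → Fam γ → Set
  DegenerateAlongT {V = V} w {γ} t =
    Σ[ γ' ∈ Ob V ] Σ[ e ∈ restr w γ' ≡ γ ] Σ[ t' ∈ Fam γ' ] subst Fam e (restrT w t') ≡ t

  restr-factor : ∀ {U U' V} {w : Hom U V} {w' : Hom U' V} (ψ : Hom U U') →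
                 (w' ∘H ψ) ≈H w → (δ' : Ob V) {δ : Ob U'} →
                 restr w' δ' ≡ δ → restr w δ' ≡ restr ψ δ
  restr-factor {w' = w'} ψ e δ' eδ =
    trans (sym (restr-≈ e δ')) (trans (restr-∘ w' ψ δ') (cong (restr ψ) eδ))

  pull : ∀ {U U' V} {w : Hom U V} {w' : Hom U' V} (ψ : Hom U U') →
         (w' ∘H ψ) ≈H w → {δ : Ob U'} → DegenerateAlong w' δ → DegenerateAlong w (restr ψ δ)
  pull ψ e (δ' , eδ) = δ' , restr-factor ψ e δ' eδ

  pullT : ∀ {U U' V} {w : Hom U V} {w' : Hom U' V} (ψ : Hom U U') →
          (w' ∘H ψ) ≈H w → {δ : Ob U'} {s : Fam δ} →
          DegenerateAlongT w' s → DegenerateAlongT w (restrT ψ s)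
  pullT {w = w} {w'} ψ e {s = s} (δ' , eδ , s' , q) = δ' , eγ , s' , subst-≅ eγ restricted
    where
    eγ : restr w δ' ≡ restr ψ _
    eγ = restr-factor ψ e δ' eδ
    restricted : restrT w s' ≅ restrT ψ s
    restricted = H.trans (H.sym (restrT-≈ᴴ e s'))
                 (H.trans (restrT-∘ᴴ w' ψ s') (restrT-congᴴ ψ eδ (≅-subst eδ q)))

  DegenerateAlongT-≅ : ∀ {U V} {w : Hom U V} {γ₁ γ₂ : Ob U} → γ₁ ≡ γ₂ →
                       {t₁ : Fam γ₁} {t₂ : Fam γ₂} → t₁ ≅ t₂ →
                       DegenerateAlongT w t₁ → DegenerateAlongT w t₂
  DegenerateAlongT-≅ refl H.refl d = d

  retract : ∀ {U U'} {ρ : Hom U U'} {σ : Hom U' U} → (σ ∘H ρ) ≈H idH →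
            (γ : Ob U) → restr ρ (restr σ γ) ≡ γ
  retract {ρ = ρ} {σ} e γ = trans (sym (restr-∘ σ ρ γ)) (trans (restr-≈ e γ) (restr-id γ))

  retractT : ∀ {U U'} {ρ : Hom U U'} {σ : Hom U' U} → (σ ∘H ρ) ≈H idH →
             {γ : Ob U} (t : Fam γ) → restrT ρ (restrT σ t) ≅ t
  retractT {ρ = ρ} {σ} e t =
    H.trans (H.sym (restrT-∘ᴴ σ ρ t)) (H.trans (restrT-≈ᴴ e t) (restrT-idᴴ t))

  transfer : ∀ {U U' V} (w : Hom U V) (w' : Hom U' V) (ρ : Hom U U') (σ : Hom U' U) →
             (w' ∘H ρ) ≈H w → (w ∘H σ) ≈H w' → (σ ∘H ρ) ≈H idH →
             (∀ δ (s : Fam δ) → DegenerateAlong w' δ → DegenerateAlongT w' s) →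
             ∀ γ (t : Fam γ) → DegenerateAlong w γ → DegenerateAlongT w t
  transfer w w' ρ σ w'ρ≈w wσ≈w' σρ≈id discrete' γ t γ-degenerate =
    DegenerateAlongT-≅ (retract σρ≈id γ) (retractT σρ≈id t)
      (pullT ρ w'ρ≈w (discrete' (restr σ γ) (restrT σ t) (pull σ wσ≈w' γ-degenerate)))

module MoveToFront (m n : ℕ) (i : Fin (ℕ.suc n)) where

  ♯weaken : Hom (♯ (m ∣ ℕ.suc n)) (♯ (m ∣ n))
  ♯weaken = ♯H (weaken i)

  weaken₀ : Hom (0 ∣ ℕ.suc (m + n)) (0 ∣ (m + n))
  weaken₀ = weaken zero

  front : Hom (♯ (m ∣ ℕ.suc n)) (0 ∣ ℕ.suc (m + n))
  front = hom (λ ()) frontP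
    where
    frontP : Fin (ℕ.suc (m + n)) → PVal 0 (m + ℕ.suc n)
    frontP zero    = pp (m ↑ʳ i)
    frontP (suc k) = pmap ♯weaken k

  backVar : Fin m ⊎ Fin (ℕ.suc n) → PVal 0 (ℕ.suc (m + n))
  backVar (inj₁ a) = pp (suc (a ↑ˡ n))
  backVar (inj₂ b) with i ≟ b
  ... | yes _  = pp zero
  ... | no i≢b = pp (suc (m ↑ʳ punchOut i≢b))

  back : Hom (0 ∣ ℕ.suc (m + n)) (♯ (m ∣ ℕ.suc n))
  back = hom (λ ()) (λ x → backVar (splitAt m x))

  weaken₀∘front : (weaken₀ ∘H front) ≈H ♯weaken
  weaken₀∘front = mk≈ (λ ()) (λ k → refl)

  front∘back : (front ∘H back) ≈H idH
  front∘back = mk≈ (λ ()) frontBack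
    where
    weakenedVar : ∀ k s → splitAt m k ≡ s →
                  substP back (♯case (weaken {m} {n} i) s) ≡ pp (suc k)
    weakenedVar k (inj₁ a) e rewrite splitAt-↑ˡ m a (ℕ.suc n) =
      cong (λ z → pp (suc z)) (splitAt⁻¹-↑ˡ e)
    weakenedVar k (inj₂ b) e rewrite splitAt-↑ʳ m (ℕ.suc n) (punchIn i b) with i ≟ punchIn i b
    ... | yes i≡ = contradiction (sym i≡) (punchInᵢ≢i i b)
    ... | no i≢ = cong (λ z → pp (suc z))
      (trans (cong (m ↑ʳ_) (punchIn-injective i _ _ (punchIn-punchOut i≢))) (splitAt⁻¹-↑ʳ e))

    frontBack : ∀ k → substP back (pmap front k) ≡ pp k
    frontBack zero rewrite splitAt-↑ʳ m (ℕ.suc n) i with i ≟ i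
    ... | yes _  = refl
    ... | no i≢i = contradiction refl i≢i
    frontBack (suc k) = weakenedVar k (splitAt m k) refl

  -- (∖ 0) sends k to suc k, which front∘back fixes
  ♯weaken∘back : (♯weaken ∘H back) ≈H weaken₀
  ♯weaken∘back = mk≈ (λ ()) (λ k → _≈H_.p≈ front∘back (suc k))

  back∘front : (back ∘H front) ≈H idH
  back∘front = mk≈ (λ ()) (λ x → backFront x (splitAt m x) refl)
    where
    backFront : ∀ x s → splitAt m x ≡ s → substP front (backVar s) ≡ pp x
    backFront x (inj₁ a) e rewrite splitAt-↑ˡ m a n = cong pp (splitAt⁻¹-↑ˡ e)
    backFront x (inj₂ b) e with i ≟ b
    ... | yes refl = cong pp (splitAt⁻¹-↑ʳ e)
    ... | no i≢b rewrite splitAt-↑ʳ m n (punchOut i≢b) =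
      cong pp (trans (cong (m ↑ʳ_) (punchIn-punchOut i≢b)) (splitAt⁻¹-↑ʳ e))

-- Degeneracy of P T in i is degeneracy of T along ♯(∖ i), which is (∖ 0)
-- up to the isomorphism front; discreteness of T at 0 then transfers.
lemma4p21 : (Γ : PSh) (T : Ty Γ) → Discrete T → Discrete (PTy T)
lemma4p21 Γ T discrete {m} {n} i =
  transfer T ♯weaken weaken₀ front back weaken₀∘front ♯weaken∘back back∘front (discrete zero)
  where open MoveToFront m n i
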